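{- Let $\mathsf{L}$ be any of the logics $\mathsf{N}_\preccurlyeq$, $\mathsf{NN}_\preccurlyeq$, $\mathsf{NT}_\preccurlyeq$, $\mathsf{NW}_\preccurlyeq$, $\mathsf{NC}_\preccurlyeq$, $\mathsf{NU}_\preccurlyeq$, $\mathsf{NNU}_\preccurlyeq$, $\mathsf{NTU}_\preccurlyeq$, $\mathsf{NWU}_\preccurlyeq$, $\mathsf{NCU}_\preccurlyeq$, $\mathsf{NA}_\preccurlyeq$, $\mathsf{NNA}_\preccurlyeq$, $\mathsf{NTA}_\preccurlyeq$, $\mathsf{NWA}_\preccurlyeq$, $\mathsf{NCA}_\preccurlyeq$. For every formula $A$, if $A$ is derivable in $\mathsf{L}$, then $A$ is valid in all $\mathsf{L}$-models.
   Context: Language: formulas are given by $A ::= p \mid \bot \mid A\to A \mid A \preccurlyeq A$ with $p$ ranging over a countable set $Atm$ of propositional variables; $\top,\neg,\wedge,\vee$ are defined as usual from $\bot,\to$. A neighbourhood model is $\mathcal M=\langle W,N,V\rangle$ with $W\neq\emptyset$, $V:Atm\to\mathcal P(W)$, and $N:W\to\mathcal P(\mathcal P(W))$ such that $\emptyset\notin N(w)$ for all $w$. Forcing: $w\Vdash p$ iff $w\in V(p)$; $w\not\Vdash\bot$; $w\Vdash B\to C$ iff $w\Vdash B$ implies $w\Vdash C$; $w\Vdash B\preccurlyeq C$ iff for all $\alpha\in N(w)$, if some $v\in\alpha$ has $v\Vdash C$ then some $u\in\alpha$ has $u\Vdash B$. $A$ is valid in $\mathcal M$ if forced at every world, and valid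 in a class if valid in each model of the class. Model conditions (for all $w$): (N) $N(w)\neq\emptyset$; (T) there is $\alpha\in N(w)$ with $w\in\alpha$; (W) $N(w)\neq\emptyset$ and $w\in\alpha$ for all $\alpha\in N(w)$; (C) $\{w\}\in N(w)$ and $w\in\alpha$ for all $\alpha\in N(w)$; (U) if $\alpha\in N(w)$ and $v\in\alpha$ then $\bigcup N(v)=\bigcup N(w)$; (A) if $\alpha\in N(w)$ and $v\in\alpha$ then $N(v)=N(w)$. Axioms and rules: (cpr) from $A\to B$ infer $B\preccurlyeq A$; (tr) $(A\preccurlyeq B)\wedge(B\preccurlyeq C)\to(A\preccurlyeq C)$; (or) $(A\preccurlyeq B)\wedge(A\preccurlyeq C)\to(A\preccurlyeq B\vee C)$; (n) $\neg(\bot\preccurlyeq\top)$; (t) $(\bot\preccurlyeq A)\to\neg A$; (w) $A\to(A\preccurlyeq\top)$; (c) $(A\preccurlyeq\top)\to A$; (u$-$) $\neg(\bot\preccurlyeq A)\to(\bot\preccurlyeq(\bot\preccurlyeq A))$; (u) $(\bot\preccurlyeq A)\to(\bot\preccurlyeq\neg(\bot\preccurlyeq A))$; (a$-$) $(A\preccurlyeq B)\to(\bot\preccurlyeq\neg(A\preccurlyeq B))$; (a) $\neg(A\preccurlyeq B)\to(\bot\preccurlyeq(A\preccurlyeq B))$. Logics: $\mathsf{N}_\preccurlyeq$ = classical propositional logic (in this language) plus tr, or, cpr; $\mathsf{NN}_\preccurlyeq=\mathsf N_\preccurlyeq+$n; $\mathsf{NT}_\preccurlyeq=\mathsf N_\preccurlyeq+$t;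 $\mathsf{NW}_\preccurlyeq=\mathsf{NT}_\preccurlyeq+$w; $\mathsf{NC}_\preccurlyeq=\mathsf{NW}_\preccurlyeq+$c; for each such $\mathsf{L}$ (written $\mathsf{N}X_\preccurlyeq$), $\mathsf{N}XU_\preccurlyeq=\mathsf L+$u$-$,u and $\mathsf{N}XA_\preccurlyeq=\mathsf L+$a$-$,a. $A$ is derivable in $\mathsf L$ if there is a finite sequence ending in $A$ each element of which is an axiom of $\mathsf L$ or follows from earlier ones by modus ponens or cpr. An $\mathsf L$-model is a neighbourhood model satisfying the conditions named by the letters after the initial N in the name of $\mathsf L$ (e.g. $\mathsf{NTU}_\preccurlyeq$-models satisfy (T) and (U); $\mathsf N_\preccurlyeq$-models are all neighbourhood models). -}

module Defs where

open import Level using (Level; Lift; lift; 0ℓ) renaming (suc to lsuc)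
open import Data.Nat using (ℕ)
open import Data.Empty using (⊥)
open import Data.Unit using (⊤)
open import Data.Product using (Σ; ∃; ∃-syntax; _×_; _,_)
open import Relation.Binary.PropositionalEquality using (_≡_)

infixr 5 _⇒_
infix 6 _≼_

data Form : Set where
  atom : ℕ → Form
  fls  : Form
  _⇒_  : Form → Form → Form
  _≼_  : Form → Form → Form

neg : Form → Form
neg A = A ⇒ fls

tru : Form
tru = fls ⇒ fls

_∨'_ : Form → Form → Form
A ∨' B = neg A ⇒ B

_∧'_ : Form → Form → Form
A ∧' B = neg (A ⇒ neg B)

-- Neighbourhood models.  Subsets of W are predicates W → Set;
-- N w is a set of subsets, i.e. a predicate on predicates.

record Model : Set₁ where
  field
    W      : Set
    N      : W → (W → Set) → Set
    V      : ℕ → W → Set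
    W-ne   : W
    ∅∉N    : ∀ w (α : W → Set) → N w α → ∃[ v ] α v

module _ (M : Model) where
  open Model M

  _⊩_ : W → Form → Set₁
  w ⊩ atom p = Lift (lsuc 0ℓ) (V p w)
  w ⊩ fls    = Lift (lsuc 0ℓ) ⊥
  w ⊩ (B ⇒ C) = w ⊩ B → w ⊩ C
  w ⊩ (B ≼ C) = (α : W → Set) → N w α →
                  (Σ W λ v → α v × v ⊩ C) → (Σ W λ u → α u × u ⊩ B)

  Valid : Form → Set₁
  Valid A = (w : W) → w ⊩ A

  _≐_ : (W → Set) → (W → Set) → Set
  α ≐ β = ∀ v → (α v → β v) × (β v → α v)

  ⋃N : W → W → Set₁
  ⋃N w u = ∃[ α ] (N w α × α u)

  CondN : Set₁
  CondN = ∀ w → ∃[ α ] N w α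

  CondT : Set₁
  CondT = ∀ w → ∃[ α ] (N w α × α w)

  CondW : Set₁
  CondW = (∀ w → ∃[ α ] N w α) × (∀ w α → N w α → α w)

  CondC : Set₁
  CondC = (∀ w → ∃[ α ] (N w α × (∀ v → (α v → v ≡ w) × (v ≡ w → α v))))
        × (∀ w α → N w α → α w)

  CondU : Set₁
  CondU = ∀ w α v → N w α → α v →
            ∀ u → (⋃N v u → ⋃N w u) × (⋃N w u → ⋃N v u)

  CondA : Set₁
  CondA = ∀ w α v → N w α → α v →
            (∀ β → N v β → ∃[ γ ] (N w γ × β ≐ γ))
          × (∀ β → N w β → ∃[ γ ] (N v γ × β ≐ γ))

data Base : Set where
  bN bNN bNT bNW bNC : Base

data Ext : Set where
  eNone eU eA : Ext

record Logic : Set where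
  constructor logic
  field
    base : Base
    ext  : Ext

data HasN : Base → Set where
  n-NN : HasN bNN

data HasT : Base → Set where
  t-NT : HasT bNT
  t-NW : HasT bNW
  t-NC : HasT bNC

data HasW : Base → Set where
  w-NW : HasW bNW
  w-NC : HasW bNC

data HasC : Base → Set where
  c-NC : HasC bNC

-- derivability: classical propositional logic is given by a standard
-- Hilbert axiomatisation (K, S, contraposition, modus ponens) over the
-- whole language; plus tr, or, cpr and the logic-specific axioms.
data _⊢_ (L : Logic) : Form → Set where
  ax-K  : ∀ A B → L ⊢ (A ⇒ (B ⇒ A))
  ax-S  : ∀ A B C → L ⊢ ((A ⇒ (B ⇒ C)) ⇒ ((A ⇒ B) ⇒ (A ⇒ C)))
  ax-CP : ∀ A B → L ⊢ ((neg A ⇒ neg B) ⇒ (B ⇒ A))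
  mp    : ∀ {A B} → L ⊢ (A ⇒ B) → L ⊢ A → L ⊢ B
  cpr   : ∀ {A B} → L ⊢ (A ⇒ B) → L ⊢ (B ≼ A)
  ax-tr : ∀ A B C → L ⊢ (((A ≼ B) ∧' (B ≼ C)) ⇒ (A ≼ C))
  ax-or : ∀ A B C → L ⊢ (((A ≼ B) ∧' (A ≼ C)) ⇒ (A ≼ (B ∨' C)))
  ax-n  : HasN (Logic.base L) → L ⊢ neg (fls ≼ tru)
  ax-t  : HasT (Logic.base L) → ∀ A → L ⊢ ((fls ≼ A) ⇒ neg A)
  ax-w  : HasW (Logic.base L) → ∀ A → L ⊢ (A ⇒ (A ≼ tru))
  ax-c  : HasC (Logic.base L) → ∀ A → L ⊢ ((A ≼ tru) ⇒ A)
  ax-u⁻ : Logic.ext L ≡ eU → ∀ A →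
          L ⊢ (neg (fls ≼ A) ⇒ (fls ≼ (fls ≼ A)))
  ax-u  : Logic.ext L ≡ eU → ∀ A →
          L ⊢ ((fls ≼ A) ⇒ (fls ≼ neg (fls ≼ A)))
  ax-a⁻ : Logic.ext L ≡ eA → ∀ A B →
          L ⊢ ((A ≼ B) ⇒ (fls ≼ neg (A ≼ B)))
  ax-a  : Logic.ext L ≡ eA → ∀ A B →
          L ⊢ (neg (A ≼ B) ⇒ (fls ≼ (A ≼ B)))

BaseCond : Base → Model → Set₁
BaseCond bN  M = Lift (lsuc 0ℓ) ⊤
BaseCond bNN M = CondN M
BaseCond bNT M = CondT M
BaseCond bNW M = CondW M
BaseCond bNC M = CondC M

ExtCond : Ext → Model → Set₁
ExtCond eNone M = Lift (lsuc 0ℓ) ⊤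
ExtCond eU    M = CondU M
ExtCond eA    M = CondA M

IsModelOf : Logic → Model → Set₁
IsModelOf (logic b e) M = BaseCond b M × ExtCond e M

{-# OPTIONS --safe #-}
module Submission where

-- Forcing of → is the constructive function space, so excluded middle is
-- needed only for the propositional axioms and for (or).  The modal axioms
-- rest on two observations: w ⊩ fls ≼ A says that no world of ⋃N(w) forces
-- A, and w ⊩ A ≼ B depends only on N(w).  Hence (U), resp. (A), makes these
-- formulas constant on the neighbourhoods of w.

open import Defs
open import Level using (0ℓ; lower) renaming (suc to lsuc)
open import Axiom.ExcludedMiddle using (ExcludedMiddle)
open import Data.Empty using (⊥-elim)
open import Data.Product using (∃-syntax; _×_; _,_; proj₁; proj₂)
open import Relation.Nullary using (yes; no)
open import Relation.Binary.PropositionalEquality using (refl; subst)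

module _ (M : Model) where
  open Model M

  private
    _⊩ₘ_ : W → Form → Set₁
    _⊩ₘ_ = _⊩_ M

  CondW⇒CondT : CondW M → CondT M
  CondW⇒CondT (nonempty , reflexive) w =
    let α , wα = nonempty w in α , wα , reflexive w α wα

  CondC⇒CondW : CondC M → CondW M
  CondC⇒CondW (singleton , reflexive) =
    (λ w → let α , wα , _ = singleton w in α , wα) , reflexive

  HasT⇒CondT : ∀ {b} → HasT b → BaseCond b M → CondT M
  HasT⇒CondT t-NT c = c
  HasT⇒CondT t-NW c = CondW⇒CondT c
  HasT⇒CondT t-NC c = CondW⇒CondT (CondC⇒CondW c)

  HasW⇒CondW : ∀ {b} → HasW b → BaseCond b M → CondW M
  HasW⇒CondW w-NW c = c
  HasW⇒CondW w-NC c = CondC⇒CondW c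

  fls≼-intro : ∀ {w} A → (∀ α → N w α → ∀ v → α v → v ⊩ₘ A → v ⊩ₘ fls) →
               w ⊩ₘ (fls ≼ A)
  fls≼-intro A none α wα (v , αv , vA) = v , αv , none α wα v αv vA

  fls≼-elim : ∀ {w} A → w ⊩ₘ (fls ≼ A) →
              ∀ α → N w α → ∀ v → α v → v ⊩ₘ A → v ⊩ₘ fls
  fls≼-elim A wfA α wα v αv vA = proj₂ (proj₂ (wfA α wα (v , αv , vA)))

  fls≼-transfer : ∀ {w v} A → (∀ u → ⋃N M v u → ⋃N M w u) →
                  w ⊩ₘ (fls ≼ A) → v ⊩ₘ (fls ≼ A)
  fls≼-transfer A ⋃v⊆⋃w wfA = fls≼-intro A λ γ vγ u γu uA →
    let α , wα , αu = ⋃v⊆⋃w u (γ , vγ , γu) in fls≼-elim A wfA α wα u αu uA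

  ≼-transfer : ∀ {w v} A B → (∀ β → N v β → ∃[ γ ] (N w γ × _≐_ M β γ)) →
               w ⊩ₘ (A ≼ B) → v ⊩ₘ (A ≼ B)
  ≼-transfer A B Nv⊆Nw wAB β vβ (x , βx , xB) =
    let γ , wγ , β≐γ = Nv⊆Nw β vβ
        u , γu , uA = wAB γ wγ (x , proj₁ (β≐γ x) βx , xB)
    in u , proj₂ (β≐γ u) γu , uA

  cpr-sound : ∀ {A B} → Valid M (A ⇒ B) → Valid M (B ≼ A)
  cpr-sound A⇒B w α wα (v , αv , vA) = v , αv , A⇒B v vA

  tr-sound : ∀ {A B C w} → w ⊩ₘ (A ≼ B) → w ⊩ₘ (B ≼ C) → w ⊩ₘ (A ≼ C)
  tr-sound AB BC α wα C∈α = AB α wα (BC α wα C∈α)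

  n-sound : CondN M → Valid M (neg (fls ≼ tru))
  n-sound nonempty w wf⊤ =
    let α , wα = nonempty w
        v , αv = ∅∉N w α wα
    in fls≼-elim tru wf⊤ α wα v αv (λ f → f)

  t-sound : CondT M → ∀ A → Valid M ((fls ≼ A) ⇒ neg A)
  t-sound reflexive A w wfA wA =
    let α , wα , αw = reflexive w in fls≼-elim A wfA α wα w αw wA

  w-sound : CondW M → ∀ A → Valid M (A ⇒ (A ≼ tru))
  w-sound (_ , reflexive) A w wA α wα _ = w , reflexive w α wα , wA

  -- {w} is a neighbourhood of w, so some element of it, i.e. w itself, forces A.
  c-sound : CondC M → ∀ A → Valid M ((A ≼ tru) ⇒ A)
  c-sound (singleton , _) A w wA≼⊤ =
    let α , wα , α≐w = singleton w
        u , αu , uA = wA≼⊤ α wα (w , proj₂ (α≐w w) refl , λ f → f)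
    in subst (_⊩ₘ A) (proj₁ (α≐w u) αu) uA

  u⁻-sound : CondU M → ∀ A → Valid M (neg (fls ≼ A) ⇒ (fls ≼ (fls ≼ A)))
  u⁻-sound same⋃ A w w¬fA = fls≼-intro (fls ≼ A) λ β wβ v βv vfA →
    w¬fA (fls≼-transfer A (λ u → proj₂ (same⋃ w β v wβ βv u)) vfA)

  u-sound : CondU M → ∀ A → Valid M ((fls ≼ A) ⇒ (fls ≼ neg (fls ≼ A)))
  u-sound same⋃ A w wfA = fls≼-intro (neg (fls ≼ A)) λ β wβ v βv v¬fA →
    v¬fA (fls≼-transfer A (λ u → proj₁ (same⋃ w β v wβ βv u)) wfA)

  a⁻-sound : CondA M → ∀ A B → Valid M ((A ≼ B) ⇒ (fls ≼ neg (A ≼ B)))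
  a⁻-sound sameN A B w wAB = fls≼-intro (neg (A ≼ B)) λ β wβ v βv v¬AB →
    v¬AB (≼-transfer A B (proj₁ (sameN w β v wβ βv)) wAB)

  a-sound : CondA M → ∀ A B → Valid M (neg (A ≼ B) ⇒ (fls ≼ (A ≼ B)))
  a-sound sameN A B w w¬AB = fls≼-intro (A ≼ B) λ β wβ v βv vAB →
    w¬AB (≼-transfer A B (proj₂ (sameN w β v wβ βv)) vAB)

  module Classical (lem : ExcludedMiddle (lsuc 0ℓ)) where

    ⊩-dne : ∀ {w} A → w ⊩ₘ neg (neg A) → w ⊩ₘ A
    ⊩-dne {w} A ¬¬A with lem {w ⊩ₘ A}
    ... | yes wA = wA
    ... | no w¬A = ⊥-elim (lower (¬¬A λ wA → ⊥-elim (w¬A wA)))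

    ∧-elim : ∀ {w} A B → w ⊩ₘ (A ∧' B) → w ⊩ₘ A × w ⊩ₘ B
    ∧-elim A B wA∧B =
      ⊩-dne A (λ w¬A → wA∧B λ wA → ⊥-elim (lower (w¬A wA))) ,
      ⊩-dne B (λ w¬B → wA∧B λ _ → w¬B)

    contraposition-sound : ∀ A B → Valid M ((neg A ⇒ neg B) ⇒ (B ⇒ A))
    contraposition-sound A B w ¬A⇒¬B wB = ⊩-dne A λ w¬A → ¬A⇒¬B w¬A wB

    or-sound : ∀ {A B C w} → w ⊩ₘ (A ≼ B) → w ⊩ₘ (A ≼ C) → w ⊩ₘ (A ≼ (B ∨' C))
    or-sound {B = B} AB AC α wα (v , αv , vB∨C) with lem {v ⊩ₘ B}
    ... | yes vB = AB α wα (v , αv , vB)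
    ... | no v¬B = AC α wα (v , αv , vB∨C λ vB → ⊥-elim (v¬B vB))

    sound : ∀ {b e} → BaseCond b M → ExtCond e M →
            ∀ {A} → logic b e ⊢ A → Valid M A
    sound bc ec (ax-K A B) w wA _ = wA
    sound bc ec (ax-S A B C) w f g wA = f wA (g wA)
    sound bc ec (ax-CP A B) = contraposition-sound A B
    sound bc ec (mp ⊢A⇒B ⊢A) w = sound bc ec ⊢A⇒B w (sound bc ec ⊢A w)
    sound bc ec (cpr ⊢A⇒B) = cpr-sound (sound bc ec ⊢A⇒B)
    sound bc ec (ax-tr A B C) w AB∧BC =
      let AB , BC = ∧-elim (A ≼ B) (B ≼ C) AB∧BC in tr-sound AB BC
    sound bc ec (ax-or A B C) w AB∧AC =
      let AB , AC = ∧-elim (A ≼ B) (A ≼ C) AB∧AC in or-sound AB AC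
    sound bc ec (ax-n n-NN) = n-sound bc
    sound bc ec (ax-t hasT A) = t-sound (HasT⇒CondT hasT bc) A
    sound bc ec (ax-w hasW A) = w-sound (HasW⇒CondW hasW bc) A
    sound bc ec (ax-c c-NC A) = c-sound bc A
    sound bc ec (ax-u⁻ refl A) = u⁻-sound ec A
    sound bc ec (ax-u refl A) = u-sound ec A
    sound bc ec (ax-a⁻ refl A B) = a⁻-sound ec A B
    sound bc ec (ax-a refl A B) = a-sound ec A B

theorem3p2 : ExcludedMiddle (lsuc 0ℓ) →
    (L : Logic) (A : Form) → L ⊢ A →
    (M : Model) → IsModelOf L M → Valid M A
theorem3p2 lem (logic b e) A ⊢A M (bc , ec) = Classical.sound M lem bc ec ⊢A
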